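{- Let $G$ be a finite simple graph and let $H = 2G$ be the disjoint union of two copies of $G$ with no edges between them. The following are equivalent: (1) $H$ is polar; (2) $G$ is monopolar; (3) $H$ is monopolar.
   Context: A union of disjoint cliques is a graph whose vertex set can be partitioned into blocks so that two vertices are adjacent iff they lie in the same block. A partition $(A,B)$ of $V(G)$ (parts possibly empty) is polar if $\overline{G[A]}$ and $G[B]$ are both unions of disjoint cliques, where $G[S]$ is the induced subgraph and $\overline{\cdot}$ the complement. A polar partition $(A,B)$ is monopolar if $A$ is an independent set. A graph is polar (resp. monopolar) if it admits a polar (resp. monopolar) partition. -}

module Defs where

open import Data.Nat using (ℕ)
open import Data.Fin using (Fin)
open import Data.Bool using (Bool; true; false)
open import Data.Sum using (_⊎_; inj₁; inj₂)
open import Data.Product using (_×_; Σ; _,_)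
open import Data.Empty using (⊥)
open import Relation.Nullary using (¬_)
open import Relation.Binary.PropositionalEquality using (_≡_)
open import Function.Bundles using (_⇔_)
open import Level using (0ℓ)

record Graph (V : Set) : Set₁ where
  field
    Adj   : V → V → Set
    sym   : ∀ {u v} → Adj u v → Adj v u
    irrefl : ∀ {v} → ¬ Adj v v
open Graph public

FinGraph : ℕ → Set₁
FinGraph n = Graph (Fin n)

complement : ∀ {V : Set} → Graph V → Graph V
complement G = record
  { Adj = λ u v → ¬ (u ≡ v) × ¬ Adj G u v
  ; sym = λ { (u≢v , ¬a) → (λ e → u≢v (Relation.Binary.PropositionalEquality.sym e)) , (λ a → ¬a (Graph.sym G a)) }
  ; irrefl = λ { (v≢v , _) → v≢v Relation.Binary.PropositionalEquality.refl }
  }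

-- The induced subgraph G[S] is a union of disjoint cliques iff the vertices of S
-- can be partitioned into blocks (labelled by block : V → ℕ) so that two distinct
-- vertices of S are adjacent iff they lie in the same block.
IsUnionOfCliquesOn : ∀ {V : Set} → Graph V → (V → Bool) → Set
IsUnionOfCliquesOn {V} G S =
  Σ (V → ℕ) λ block →
    ∀ u v → S u ≡ true → S v ≡ true → ¬ (u ≡ v) →
      (Adj G u v ⇔ (block u ≡ block v))

-- A partition (A , B) of V is encoded by inA : V → Bool  (A = inA⁻¹ true, B = inA⁻¹ false).
inB : ∀ {V : Set} → (V → Bool) → V → Bool
inB inA v with inA v
... | true  = false
... | false = true

-- (A , B) polar: complement of G[A] and G[B] are unions of disjoint cliques.
-- (The complement of G[A] equals (complement G)[A].)
IsPolarPartition : ∀ {V : Set} → Graph V → (V → Bool) → Set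
IsPolarPartition G inA =
  IsUnionOfCliquesOn (complement G) inA × IsUnionOfCliquesOn G (inB inA)

IsIndependent : ∀ {V : Set} → Graph V → (V → Bool) → Set
IsIndependent G S = ∀ u v → S u ≡ true → S v ≡ true → ¬ Adj G u v

IsMonopolarPartition : ∀ {V : Set} → Graph V → (V → Bool) → Set
IsMonopolarPartition G inA = IsPolarPartition G inA × IsIndependent G inA

IsPolar : ∀ {V : Set} → Graph V → Set
IsPolar {V} G = Σ (V → Bool) λ inA → IsPolarPartition G inA

IsMonopolar : ∀ {V : Set} → Graph V → Set
IsMonopolar {V} G = Σ (V → Bool) λ inA → IsMonopolarPartition G inA

AdjTwo : ∀ {V : Set} → Graph V → V ⊎ V → V ⊎ V → Set
AdjTwo G (inj₁ u) (inj₁ v) = Adj G u v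
AdjTwo G (inj₂ u) (inj₂ v) = Adj G u v
AdjTwo G (inj₁ _) (inj₂ _) = ⊥
AdjTwo G (inj₂ _) (inj₁ _) = ⊥

twoCopies : ∀ {V : Set} → Graph V → Graph (V ⊎ V)
twoCopies G = record { Adj = AdjTwo G ; sym = λ {u} {v} → s {u} {v} ; irrefl = λ {v} → i {v} }
  where
  s : ∀ {u v} → AdjTwo G u v → AdjTwo G v u
  s {inj₁ _} {inj₁ _} a = Graph.sym G a
  s {inj₂ _} {inj₂ _} a = Graph.sym G a
  s {inj₁ _} {inj₂ _} ()
  s {inj₂ _} {inj₁ _} ()
  i : ∀ {v} → ¬ AdjTwo G v v
  i {inj₁ _} = Graph.irrefl G
  i {inj₂ _} = Graph.irrefl G

-- If A meets both copies of G in a polar partition (A , B) of 2G, a vertex w of A in the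
-- second copy is co-adjacent to every vertex of A in the first copy, so in the union of
-- cliques complement(2G)[A] they all share the block of w: A is independent on the first
-- copy, and restricting (A , B) to it is a monopolar partition of G. If A misses the second
-- copy, that copy lies in B, so G is itself a union of cliques, which is monopolar with
-- A = ∅. Conversely a monopolar partition of G, taken on both copies, is one of 2G.
module Submission where

open import Defs
open import Data.Bool using (Bool; true; false; not; _≟_)
open import Data.Bool.Properties using (¬-not)
open import Data.Empty using (⊥-elim)
open import Data.Fin.Properties using (any?)
open import Data.Nat using (ℕ; suc; _*_)
open import Data.Nat.Properties using (even≢odd; *-cancelˡ-≡; suc-injective)
open import Data.Product using (_×_; _,_; proj₁; proj₂)
open import Data.Sum using (_⊎_; inj₁; inj₂; [_,_]) renaming (map to ⊎-map)
open import Data.Sum.Properties using (inj₁-injective; inj₂-injective)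
open import Function using (_∘_; id)
open import Function.Bundles using (_⇔_; mk⇔; Equivalence)
open import Function.Construct.Composition using (_⇔-∘_)
open import Function.Construct.Identity using (⇔-id)
open import Relation.Nullary using (¬_; yes; no)
open import Relation.Binary.PropositionalEquality
  using (_≡_; _≢_; refl; cong; trans) renaming (sym to ≡-sym)

open Equivalence using (to; from)

inB-not : ∀ {V : Set} (S : V → Bool) v → inB S v ≡ not (S v)
inB-not S v with S v
... | true  = refl
... | false = refl

inB-∘ : ∀ {W V : Set} (S : V → Bool) (f : W → V) v → inB (S ∘ f) v ≡ inB S (f v)
inB-∘ S f v = trans (inB-not (S ∘ f) v) (≡-sym (inB-not S (f v)))

record Embedding {W V : Set} (H : Graph W) (G : Graph V) : Set where
  field
    map       : W → V
    injective : ∀ {u v} → map u ≡ map v → u ≡ v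
    adjacent  : ∀ {u v} → Adj H u v ⇔ Adj G (map u) (map v)
open Embedding

module _ {V : Set} (G : Graph V) where

  idEmbedding : Embedding G G
  idEmbedding = record { map = id ; injective = id ; adjacent = ⇔-id _ }

  inj₁-embedding : Embedding G (twoCopies G)
  inj₁-embedding = record { map = inj₁ ; injective = inj₁-injective ; adjacent = ⇔-id _ }

  inj₂-embedding : Embedding G (twoCopies G)
  inj₂-embedding = record { map = inj₂ ; injective = inj₂-injective ; adjacent = ⇔-id _ }

module _ {W V : Set} {H : Graph W} {G : Graph V} (e : Embedding H G) where

  complement-embedding : Embedding (complement H) (complement G)
  complement-embedding = record
    { map       = map e
    ; injective = injective e
    ; adjacent  = mk⇔ (λ (u≢v , ¬uv) → u≢v ∘ injective e , ¬uv ∘ from (adjacent e))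
                      (λ (fu≢fv , ¬fufv) → fu≢fv ∘ cong (map e) , ¬fufv ∘ to (adjacent e))
    }

  unionOfCliques-pullback : ∀ {S : W → Bool} {T : V → Bool} →
    (∀ v → S v ≡ true → T (map e v) ≡ true) →
    IsUnionOfCliquesOn G T → IsUnionOfCliquesOn H S
  unionOfCliques-pullback S⊆T (block , adj⇔block) =
    block ∘ map e ,
    λ u v Su Sv u≢v → adj⇔block _ _ (S⊆T u Su) (S⊆T v Sv) (u≢v ∘ injective e) ⇔-∘ adjacent e

evenOdd : ℕ ⊎ ℕ → ℕ
evenOdd = [ 2 *_ , suc ∘ (2 *_) ]

evenOdd-injective : ∀ {x y} → evenOdd x ≡ evenOdd y → x ≡ y
evenOdd-injective {inj₁ m} {inj₁ n} e = cong inj₁ (*-cancelˡ-≡ m n 2 e)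
evenOdd-injective {inj₂ m} {inj₂ n} e = cong inj₂ (*-cancelˡ-≡ m n 2 (suc-injective e))
evenOdd-injective {inj₁ m} {inj₂ n} e = ⊥-elim (even≢odd m n e)
evenOdd-injective {inj₂ m} {inj₁ n} e = ⊥-elim (even≢odd n m (≡-sym e))

module _ {V : Set} (G : Graph V) where

  monopolar⇒polar : IsMonopolar G → IsPolar G
  monopolar⇒polar (A , polar , _) = A , polar

  unionOfCliques⇒monopolar : IsUnionOfCliquesOn G (λ _ → true) → IsMonopolar G
  unionOfCliques⇒monopolar cliques =
    (λ _ → false) , ((((λ _ → 0) , λ _ _ ()) , cliques) , λ _ _ ())

  -- Both u and v lie in the block of w, so they are co-adjacent.
  coNeighbours-nonadjacent : ∀ {A w} → IsUnionOfCliquesOn (complement G) A → A w ≡ true →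
    ∀ u v → A u ≡ true → A v ≡ true →
    Adj (complement G) u w → Adj (complement G) v w → ¬ Adj G u v
  coNeighbours-nonadjacent (block , co⇔block) Aw u v Au Av uw vw uv =
    proj₂ (from (co⇔block u v Au Av u≢v) (trans (to (co⇔block u _ Au Aw (proj₁ uw)) uw)
                                                (≡-sym (to (co⇔block v _ Av Aw (proj₁ vw)) vw))))
          uv
    where
    u≢v : u ≢ v
    u≢v refl = irrefl G uv

module _ {V : Set} (G : Graph V) where

  twoCopies-unionOfCliques : ∀ {U : V ⊎ V → Bool} →
    IsUnionOfCliquesOn G (U ∘ inj₁) → IsUnionOfCliquesOn G (U ∘ inj₂) →
    IsUnionOfCliquesOn (twoCopies G) U
  twoCopies-unionOfCliques {U} (block₁ , adj⇔₁) (block₂ , adj⇔₂) = block , adj⇔block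
    where
    block : V ⊎ V → ℕ
    block = evenOdd ∘ ⊎-map block₁ block₂

    adj⇔block : ∀ u v → U u ≡ true → U v ≡ true → u ≢ v →
                Adj (twoCopies G) u v ⇔ (block u ≡ block v)
    adj⇔block (inj₁ u) (inj₁ v) Uu Uv u≢v =
      mk⇔ (cong (evenOdd ∘ inj₁)) (inj₁-injective ∘ evenOdd-injective)
        ⇔-∘ adj⇔₁ u v Uu Uv (u≢v ∘ cong inj₁)
    adj⇔block (inj₂ u) (inj₂ v) Uu Uv u≢v =
      mk⇔ (cong (evenOdd ∘ inj₂)) (inj₂-injective ∘ evenOdd-injective)
        ⇔-∘ adj⇔₂ u v Uu Uv (u≢v ∘ cong inj₂)
    adj⇔block (inj₁ u) (inj₂ v) _ _ _ = mk⇔ (λ ()) (⊥-elim ∘ even≢odd (block₁ u) (block₂ v))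
    adj⇔block (inj₂ u) (inj₁ v) _ _ _ = mk⇔ (λ ()) (⊥-elim ∘ even≢odd (block₁ v) (block₂ u) ∘ ≡-sym)

  twoCopies-monopolarPartition : ∀ {A} → IsMonopolarPartition G A →
    IsMonopolarPartition (twoCopies G) [ A , A ]
  twoCopies-monopolarPartition {A} ((_ , cliques) , independentA) =
    (coCliques₂ , cliques₂) , independent₂
    where
    independent₂ : IsIndependent (twoCopies G) [ A , A ]
    independent₂ (inj₁ u) (inj₁ v) = independentA u v
    independent₂ (inj₂ u) (inj₂ v) = independentA u v
    independent₂ (inj₁ u) (inj₂ v) _ _ ()
    independent₂ (inj₂ u) (inj₁ v) _ _ ()

    coCliques₂ : IsUnionOfCliquesOn (complement (twoCopies G)) [ A , A ]
    coCliques₂ = (λ _ → 0) , λ u v Au Av u≢v →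
      mk⇔ (λ _ → refl) (λ _ → u≢v , independent₂ u v Au Av)

    cliques₂ : IsUnionOfCliquesOn (twoCopies G) (inB [ A , A ])
    cliques₂ = twoCopies-unionOfCliques
      (unionOfCliques-pullback (idEmbedding G) (λ v → trans (≡-sym (inB-∘ [ A , A ] inj₁ v))) cliques)
      (unionOfCliques-pullback (idEmbedding G) (λ v → trans (≡-sym (inB-∘ [ A , A ] inj₂ v))) cliques)

  polar-twoCopies-meeting⇒monopolarPartition : ∀ {A w} →
    IsPolarPartition (twoCopies G) A → A (inj₂ w) ≡ true → IsMonopolarPartition G (A ∘ inj₁)
  polar-twoCopies-meeting⇒monopolarPartition {A} (coCliques , cliques) Aw =
    ( unionOfCliques-pullback (complement-embedding (inj₁-embedding G)) (λ _ Av → Av) coCliques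
    , unionOfCliques-pullback (inj₁-embedding G) (λ v → trans (≡-sym (inB-∘ A inj₁ v))) cliques )
    , λ u v Au Av → coNeighbours-nonadjacent (twoCopies G) coCliques Aw (inj₁ u) (inj₁ v) Au Av
                      ((λ ()) , (λ ())) ((λ ()) , (λ ()))

  polar-twoCopies-missing⇒monopolar : ∀ {A} →
    IsPolarPartition (twoCopies G) A → (∀ v → A (inj₂ v) ≡ false) → IsMonopolar G
  polar-twoCopies-missing⇒monopolar {A} (_ , cliques) A₂≡false =
    unionOfCliques⇒monopolar G
      (unionOfCliques-pullback (inj₂-embedding G)
        (λ v _ → trans (inB-not A (inj₂ v)) (cong not (A₂≡false v))) cliques)

mainTheorem3 : ∀ (n : ℕ) (G : FinGraph n) →
    (IsPolar (twoCopies G) ⇔ IsMonopolar G) × (IsMonopolar G ⇔ IsMonopolar (twoCopies G))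
mainTheorem3 n G =
  mk⇔ polar₂⇒monopolar (monopolar⇒polar (twoCopies G) ∘ monopolar₂) ,
  mk⇔ monopolar₂ (polar₂⇒monopolar ∘ monopolar⇒polar (twoCopies G))
  where
  monopolar₂ : IsMonopolar G → IsMonopolar (twoCopies G)
  monopolar₂ (A , monopolar) = [ A , A ] , twoCopies-monopolarPartition G monopolar

  polar₂⇒monopolar : IsPolar (twoCopies G) → IsMonopolar G
  polar₂⇒monopolar (A , polar) with any? (λ v → A (inj₂ v) ≟ true)
  ... | yes (w , Aw) = A ∘ inj₁ , polar-twoCopies-meeting⇒monopolarPartition G polar Aw
  ... | no  ¬meets   = polar-twoCopies-missing⇒monopolar G polar (λ v → ¬-not (¬meets ∘ (v ,_)))
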